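{- Let $m$ be a positive integer, let $r\ge0$, and let $\lambda$ be a nonzero real number. Then for all integers $n,j\ge0$, $$W^{(r)}_{m,\lambda}(n,j)=\sum_{k=j}^n\sum_{l=j}^k\binom{n}{k}\binom{k}{l}(r-1)_{n-k,\lambda}\,(1)_{k-l,\lambda}\,m^{l-j}\,S_{2,\frac{\lambda}{m}}(l,j).$$
   Context: For real $x$ and nonzero real $\mu$, $(x)_{0,\mu}=1$, $(x)_{n,\mu}=x(x-\mu)\cdots(x-(n-1)\mu)$ for $n\ge1$; $(x)_0=1$, $(x)_k=x(x-1)\cdots(x-k+1)$. The degenerate Stirling numbers of the second kind $S_{2,\mu}(n,k)$ are defined by $(x)_{n,\mu}=\sum_{k=0}^nS_{2,\mu}(n,k)(x)_k$ (and are $0$ for $k>n$). The degenerate $r$-Whitney numbers of the second kind $W^{(r)}_{m,\lambda}(n,k)$ are defined by the polynomial identity $(mx+r)_{n,\lambda}=\sum_{k=0}^nW^{(r)}_{m,\lambda}(n,k)m^k(x)_k$ (and are $0$ for $k>n$). -}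

module Defs where

open import Level using (Level; _⊔_) renaming (suc to lsuc)
open import Data.Nat as ℕ using (ℕ; zero; suc; _∸_)
open import Data.Product using (Σ; ∃; _×_)
open import Data.Sum using (_⊎_)
open import Relation.Nullary using (¬_)
open import Relation.Binary.Core using (Rel)
open import Relation.Binary.Structures using (IsStrictTotalOrder)
open import Algebra.Bundles using (CommutativeRing)

-- Axioms of the real numbers: a complete (least-upper-bound) ordered field.
-- Any model is (classically) the real line ℝ.
record RealNumbers (c ℓ : Level) : Set (lsuc (c ⊔ ℓ)) where
  field
    commRing : CommutativeRing c ℓ
  open CommutativeRing commRing public
  field
    _<_                 : Rel Carrier ℓ
    <-isStrictTotalOrder : IsStrictTotalOrder _≈_ _<_
    +-monoˡ-<           : ∀ {x y} z → x < y → (x + z) < (y + z)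
    *-pos               : ∀ {x y} → 0# < x → 0# < y → 0# < (x * y)
    0<1                 : 0# < 1#
    inverse             : ∀ x → ¬ (x ≈ 0#) → Σ Carrier (λ y → (x * y) ≈ 1#)
  _≤_ : Rel Carrier ℓ
  x ≤ y = (x < y) ⊎ (x ≈ y)
  field
    lub : (P : Carrier → Set c) → ∃ P → ∃ (λ b → ∀ x → P x → x ≤ b) →
          ∃ (λ s → (∀ x → P x → x ≤ s) × (∀ b → (∀ x → P x → x ≤ b) → s ≤ b))

module Ops {c ℓ : Level} (R : CommutativeRing c ℓ) where
  open CommutativeRing R

  fromℕ : ℕ → Carrier
  fromℕ zero    = 0#
  fromℕ (suc n) = 1# + fromℕ n

  pow : Carrier → ℕ → Carrier
  pow x zero    = 1#
  pow x (suc n) = pow x n * x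

  dfall : Carrier → Carrier → ℕ → Carrier
  dfall x μ zero    = 1#
  dfall x μ (suc n) = dfall x μ n * (x - fromℕ n * μ)

  fall : Carrier → ℕ → Carrier
  fall x k = dfall x 1# k

  sumBelow : ℕ → (ℕ → Carrier) → Carrier
  sumBelow zero    f = 0#
  sumBelow (suc n) f = sumBelow n f + f n

  -- Σ_{k=a}^{b} f k   (empty, i.e. 0, when b < a)
  sumFromTo : ℕ → ℕ → (ℕ → Carrier) → Carrier
  sumFromTo a b f = sumBelow (suc b ∸ a) (λ i → f (a ℕ.+ i))

  -- S is the family of degenerate Stirling numbers of the second kind S_{2,μ}(n,k):
  -- (x)_{n,μ} = Σ_{k=0}^n S(n,k) (x)_k for all x, and S(n,k) = 0 for k > n.
  IsDegStirling2 : Carrier → (ℕ → ℕ → Carrier) → Set (c ⊔ ℓ)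
  IsDegStirling2 μ S =
    (∀ n x → dfall x μ n ≈ sumFromTo 0 n (λ k → S n k * fall x k)) ×
    (∀ n k → n ℕ.< k → S n k ≈ 0#)

  -- W is the family of degenerate r-Whitney numbers of the second kind W^{(r)}_{m,λ}(n,k):
  -- (mx+r)_{n,λ} = Σ_{k=0}^n W(n,k) m^k (x)_k for all x, and W(n,k) = 0 for k > n.
  IsDegWhitney2 : ℕ → Carrier → Carrier → (ℕ → ℕ → Carrier) → Set (c ⊔ ℓ)
  IsDegWhitney2 m r λ' W =
    (∀ n x → dfall (fromℕ m * x + r) λ' n
               ≈ sumFromTo 0 n (λ k → W n k * pow (fromℕ m) k * fall x k)) ×
    (∀ n k → n ℕ.< k → W n k ≈ 0#)

-- Write m x + r = (r - 1) + (1 + m x). The degenerate Vandermonde identity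
-- (a + b)_{n,λ} = Σ_k C(n,k) (a)_{n-k,λ} (b)_{k,λ}, applied twice, together with the rescaling
-- (m x)_{l,λ} = m^l (x)_{l,λ/m} and the defining expansion of S_{2,λ/m}, expands (m x + r)_{n,λ}
-- in the falling factorials (x)_j; exchanging the order of the triangular sums shows that the
-- coefficient of (x)_j is m^j times the claimed double sum. Over an ordered field the (x)_j are
-- linearly independent as functions of x (evaluate at x = 0, 1, 2, …), so comparing with the
-- defining expansion of W and cancelling m^j > 0 gives the formula.

module Submission where

open import Defs
open import Level using (Level)
open import Data.Nat using (ℕ; zero; suc; _∸_; _≤′_; ≤′-refl; ≤′-step)
import Data.Nat as ℕ
import Data.Nat.Properties as ℕ
open import Data.Nat.Induction using (<-rec)
open import Data.Nat.Combinatorics using (_C_; k>n⇒nCk≡0; nCk+nC[k+1]≡[n+1]C[k+1])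
open import Data.Product using (_,_)
open import Data.Sum using (inj₁; inj₂; [_,_]′)
open import Function using (_∘_)
open import Relation.Nullary using (¬_)
open import Relation.Binary.Structures using (IsStrictTotalOrder)
import Relation.Binary.PropositionalEquality as ≡
open import Algebra.Bundles using (CommutativeRing)

module FiniteSums {c ℓ : Level} (R : CommutativeRing c ℓ) where
  open CommutativeRing R
  open Ops R
  open import Algebra.Properties.CommutativeSemigroup +-commutativeSemigroup using (interchange)
  open import Relation.Binary.Reasoning.Setoid setoid

  sumBelow-cong : ∀ N {f g : ℕ → Carrier} → (∀ i → i ℕ.< N → f i ≈ g i) →
                  sumBelow N f ≈ sumBelow N g
  sumBelow-cong zero    f≈g = refl
  sumBelow-cong (suc N) f≈g =
    +-cong (sumBelow-cong N (λ i i<N → f≈g i (ℕ.m<n⇒m<1+n i<N)))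
           (f≈g N ℕ.≤-refl)

  sumBelow-+ : ∀ N (f g : ℕ → Carrier) →
               sumBelow N (λ i → f i + g i) ≈ sumBelow N f + sumBelow N g
  sumBelow-+ zero    f g = sym (+-identityˡ 0#)
  sumBelow-+ (suc N) f g = trans (+-congʳ (sumBelow-+ N f g)) (interchange _ _ _ _)

  *-distribˡ-sumBelow : ∀ N x (f : ℕ → Carrier) →
                        x * sumBelow N f ≈ sumBelow N (λ i → x * f i)
  *-distribˡ-sumBelow zero    x f = zeroʳ x
  *-distribˡ-sumBelow (suc N) x f =
    trans (distribˡ x _ _) (+-congʳ (*-distribˡ-sumBelow N x f))

  *-distribʳ-sumBelow : ∀ N x (f : ℕ → Carrier) →
                        sumBelow N f * x ≈ sumBelow N (λ i → f i * x)
  *-distribʳ-sumBelow zero    x f = zeroˡ x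
  *-distribʳ-sumBelow (suc N) x f =
    trans (distribʳ x _ _) (+-congʳ (*-distribʳ-sumBelow N x f))

  sumBelow-sucˡ : ∀ N (f : ℕ → Carrier) → sumBelow (suc N) f ≈ f 0 + sumBelow N (f ∘ suc)
  sumBelow-sucˡ zero    f = +-comm 0# (f 0)
  sumBelow-sucˡ (suc N) f = trans (+-congʳ (sumBelow-sucˡ N f)) (+-assoc _ _ _)

  sumBelow-vanishing-tail : ∀ (f : ℕ → Carrier) {N N′} → N ≤′ N′ →
                            (∀ i → N ℕ.≤ i → f i ≈ 0#) → sumBelow N′ f ≈ sumBelow N f
  sumBelow-vanishing-tail f ≤′-refl                   f≈0 = refl
  sumBelow-vanishing-tail f {N} (≤′-step {n = N′} N≤′N′) f≈0 = begin
    sumBelow N′ f + f N′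
      ≈⟨ +-cong (sumBelow-vanishing-tail f N≤′N′ f≈0) (f≈0 N′ (ℕ.≤′⇒≤ N≤′N′)) ⟩
    sumBelow N f + 0#
      ≈⟨ +-identityʳ _ ⟩
    sumBelow N f ∎

  sumFromTo-cong : ∀ a b {f g : ℕ → Carrier} → (∀ i → a ℕ.≤ i → f i ≈ g i) →
                   sumFromTo a b f ≈ sumFromTo a b g
  sumFromTo-cong a b f≈g = sumBelow-cong (suc b ∸ a) (λ i _ → f≈g (a ℕ.+ i) (ℕ.m≤m+n a i))

  sumFromTo-empty : ∀ {a b} → b ℕ.< a → (f : ℕ → Carrier) → sumFromTo a b f ≈ 0#
  sumFromTo-empty b<a f rewrite ℕ.m≤n⇒m∸n≡0 b<a = refl

  sumFromTo-sucʳ : ∀ {a b} → a ℕ.≤ suc b → (f : ℕ → Carrier) →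
                   sumFromTo a (suc b) f ≈ sumFromTo a b f + f (suc b)
  sumFromTo-sucʳ {a} {b} a≤1+b f rewrite ℕ.+-∸-assoc 1 a≤1+b =
    +-congˡ (reflexive (≡.cong f (ℕ.m+[n∸m]≡n a≤1+b)))

  sumFromTo-triangle : ∀ n (f : ℕ → ℕ → Carrier) →
    sumFromTo 0 n (λ k → sumFromTo 0 k (f k)) ≈
    sumFromTo 0 n (λ j → sumFromTo j n (λ k → f k j))
  sumFromTo-triangle zero    f = refl
  sumFromTo-triangle (suc n) f = begin
    sumFromTo 0 n (λ k → sumFromTo 0 k (f k)) + sumFromTo 0 (suc n) (f (suc n))
      ≈⟨ +-congʳ (sumFromTo-triangle n f) ⟩
    sumFromTo 0 n (λ j → sumFromTo j n (λ k → f k j)) + sumFromTo 0 (suc n) (f (suc n))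
      ≈⟨ +-congʳ (trans (sym (+-identityʳ _))
                        (+-congˡ (sym (sumFromTo-empty (ℕ.n<1+n n) (λ k → f k (suc n)))))) ⟩
    sumFromTo 0 (suc n) (λ j → sumFromTo j n (λ k → f k j)) + sumFromTo 0 (suc n) (f (suc n))
      ≈⟨ sym (sumBelow-+ (suc (suc n)) _ _) ⟩
    sumFromTo 0 (suc n) (λ j → sumFromTo j n (λ k → f k j) + f (suc n) j)
      ≈⟨ sumBelow-cong (suc (suc n))
                       (λ j j<2+n → sym (sumFromTo-sucʳ (ℕ.s≤s⁻¹ j<2+n) (λ k → f k j))) ⟩
    sumFromTo 0 (suc n) (λ j → sumFromTo j (suc n) (λ k → f k j)) ∎

  *-distribˡ-sumFromTo : ∀ a b x (f : ℕ → Carrier) →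
                         x * sumFromTo a b f ≈ sumFromTo a b (λ i → x * f i)
  *-distribˡ-sumFromTo a b x f = *-distribˡ-sumBelow (suc b ∸ a) x _

  *-distribʳ-sumFromTo : ∀ a b x (f : ℕ → Carrier) →
                         sumFromTo a b f * x ≈ sumFromTo a b (λ i → f i * x)
  *-distribʳ-sumFromTo a b x f = *-distribʳ-sumBelow (suc b ∸ a) x _

module DegenerateFactorials {c ℓ : Level} (R : CommutativeRing c ℓ) where
  open CommutativeRing R
  open Ops R
  open FiniteSums R
  open import Algebra.Properties.Ring ring using (x[y-z]≈xy-xz)
  open import Algebra.Properties.AbelianGroup +-abelianGroup using (⁻¹-∙-comm)
  open import Algebra.Properties.CommutativeSemigroup +-commutativeSemigroup using (interchange)
  open import Algebra.Solver.Ring.NaturalCoefficients.Default commutativeSemiring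
  open import Relation.Binary.Reasoning.Setoid setoid

  fromℕ-+ : ∀ a b → fromℕ (a ℕ.+ b) ≈ fromℕ a + fromℕ b
  fromℕ-+ zero    b = sym (+-identityˡ _)
  fromℕ-+ (suc a) b = trans (+-congˡ (fromℕ-+ a b)) (sym (+-assoc _ _ _))

  fromℕ-m∸n+n : ∀ {a b} → b ℕ.≤ a → fromℕ a ≈ fromℕ (a ∸ b) + fromℕ b
  fromℕ-m∸n+n {a} {b} b≤a =
    trans (reflexive (≡.cong fromℕ (≡.sym (ℕ.m∸n+n≡m b≤a)))) (fromℕ-+ (a ∸ b) b)

  pow-+ : ∀ x a b → pow x (a ℕ.+ b) ≈ pow x a * pow x b
  pow-+ x a zero    rewrite ℕ.+-identityʳ a = sym (*-identityʳ _)
  pow-+ x a (suc b) rewrite ℕ.+-suc a b = trans (*-congʳ (pow-+ x a b)) (*-assoc _ _ _)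

  dfall-congˡ : ∀ {x y} μ n → x ≈ y → dfall x μ n ≈ dfall y μ n
  dfall-congˡ μ zero    x≈y = refl
  dfall-congˡ μ (suc n) x≈y = *-cong (dfall-congˡ μ n x≈y) (+-congʳ x≈y)

  fall-fromℕ-vanish : ∀ {i k} → i ℕ.< k → fall (fromℕ i) k ≈ 0#
  fall-fromℕ-vanish {i} {suc k} i<1+k with ℕ.m<1+n⇒m<n∨m≡n i<1+k
  ... | inj₁ i<k = trans (*-congʳ (fall-fromℕ-vanish i<k)) (zeroˡ _)
  ... | inj₂ ≡.refl =
    trans (*-congˡ (trans (+-congˡ (-‿cong (*-identityʳ _))) (-‿inverseʳ _))) (zeroʳ _)

  dfall-scale : ∀ {M μ lam} → μ * M ≈ lam →
                ∀ x l → dfall (M * x) lam l ≈ pow M l * dfall x μ l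
  dfall-scale μM≈lam x zero    = sym (*-identityʳ 1#)
  dfall-scale {M} {μ} {lam} μM≈lam x (suc l) = begin
    dfall (M * x) lam l * (M * x - fromℕ l * lam)
      ≈⟨ *-cong (dfall-scale μM≈lam x l) (+-congˡ (-‿cong scaled-step)) ⟩
    pow M l * dfall x μ l * (M * x - M * (fromℕ l * μ))
      ≈⟨ *-congˡ (sym (x[y-z]≈xy-xz M x (fromℕ l * μ))) ⟩
    pow M l * dfall x μ l * (M * (x - fromℕ l * μ))
      ≈⟨ solve 4 (λ P D M y → (P :* D) :* (M :* y) := (P :* M) :* (D :* y)) refl _ _ _ _ ⟩
    pow M l * M * (dfall x μ l * (x - fromℕ l * μ)) ∎
    where
    scaled-step : fromℕ l * lam ≈ M * (fromℕ l * μ)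
    scaled-step = trans (*-congˡ (sym μM≈lam))
      (solve 3 (λ L u M → L :* (u :* M) := M :* (L :* u)) refl (fromℕ l) μ M)

  +-sub-+ : ∀ a b u v → (a + b) - (u + v) ≈ (a - u) + (b - v)
  +-sub-+ a b u v = trans (+-congˡ (sym (⁻¹-∙-comm u v))) (interchange a b (- u) (- v))

  module _ (a b lam : Carrier) where

    dfall-+ : ∀ n → dfall (a + b) lam n ≈
              sumFromTo 0 n (λ k → fromℕ (n C k) * dfall a lam (n ∸ k) * dfall b lam k)
    dfall-+ zero    =
      sym (trans (+-identityˡ _) (trans (*-identityʳ _) (trans (*-identityʳ _) (+-identityʳ 1#))))
    dfall-+ (suc n) = begin
      dfall (a + b) lam n * (a + b - fromℕ n * lam)
        ≈⟨ *-congʳ (dfall-+ n) ⟩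
      sumBelow (suc n) (term n) * (a + b - fromℕ n * lam)
        ≈⟨ *-distribʳ-sumBelow (suc n) _ (term n) ⟩
      sumBelow (suc n) (λ k → term n k * (a + b - fromℕ n * lam))
        ≈⟨ sumBelow-cong (suc n) (λ k k<1+n → split k (ℕ.s≤s⁻¹ k<1+n)) ⟩
      sumBelow (suc n) (λ k → raise-a k + raise-b k)
        ≈⟨ sumBelow-+ (suc n) raise-a raise-b ⟩
      sumBelow (suc n) raise-a + sumBelow (suc n) raise-b
        ≈⟨ +-congʳ (trans (sumBelow-sucˡ n raise-a)
                          (+-congˡ (sym (trans (+-congˡ raise-a-last) (+-identityʳ _))))) ⟩
      (raise-a 0 + sumBelow (suc n) (raise-a ∘ suc)) + sumBelow (suc n) raise-b
        ≈⟨ trans (+-assoc _ _ _) (+-congˡ (+-comm _ _)) ⟩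
      raise-a 0 + (sumBelow (suc n) raise-b + sumBelow (suc n) (raise-a ∘ suc))
        ≈⟨ +-congˡ (sym (sumBelow-+ (suc n) raise-b (raise-a ∘ suc))) ⟩
      raise-a 0 + sumBelow (suc n) (λ k → raise-b k + raise-a (suc k))
        ≈⟨ +-congˡ (sumBelow-cong (suc n) (λ k _ → sym (pascal k))) ⟩
      term (suc n) 0 + sumBelow (suc n) (term (suc n) ∘ suc)
        ≈⟨ sym (sumBelow-sucˡ (suc n) (term (suc n))) ⟩
      sumBelow (suc (suc n)) (term (suc n)) ∎
      where
      term : ℕ → ℕ → Carrier
      term n k = fromℕ (n C k) * dfall a lam (n ∸ k) * dfall b lam k
      raise-a : ℕ → Carrier
      raise-a k = fromℕ (n C k) * dfall a lam (suc n ∸ k) * dfall b lam k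
      raise-b : ℕ → Carrier
      raise-b k = fromℕ (n C k) * dfall a lam (n ∸ k) * dfall b lam (suc k)

      split : ∀ k → k ℕ.≤ n → term n k * (a + b - fromℕ n * lam) ≈ raise-a k + raise-b k
      split k k≤n = begin
        term n k * (a + b - fromℕ n * lam)
          ≈⟨ *-congˡ (+-congˡ (-‿cong (trans (*-congʳ (fromℕ-m∸n+n k≤n))
                                             (distribʳ lam _ _)))) ⟩
        term n k * (a + b - (fromℕ (n ∸ k) * lam + fromℕ k * lam))
          ≈⟨ *-congˡ (+-sub-+ a b _ _) ⟩
        term n k * ((a - fromℕ (n ∸ k) * lam) + (b - fromℕ k * lam))
          ≈⟨ solve 5 (λ C A B s t →
                       C :* A :* B :* (s :+ t) := C :* (A :* s) :* B :+ C :* A :* (B :* t))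
                     refl _ _ _ _ _ ⟩
        fromℕ (n C k) * dfall a lam (suc (n ∸ k)) * dfall b lam k + raise-b k
          ≡⟨ ≡.cong (λ d → fromℕ (n C k) * dfall a lam d * dfall b lam k + raise-b k)
                    (≡.sym (ℕ.+-∸-assoc 1 k≤n)) ⟩
        raise-a k + raise-b k ∎

      raise-a-last : raise-a (suc n) ≈ 0#
      raise-a-last =
        trans (*-congʳ (trans (*-congʳ (reflexive (≡.cong fromℕ (k>n⇒nCk≡0 (ℕ.n<1+n n)))))
                              (zeroˡ _)))
              (zeroˡ _)

      pascal : ∀ k → term (suc n) (suc k) ≈ raise-b k + raise-a (suc k)
      pascal k = begin
        fromℕ (suc n C suc k) * dfall a lam (n ∸ k) * dfall b lam (suc k)
          ≈⟨ *-congʳ (*-congʳ (reflexive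
               (≡.cong fromℕ (≡.sym (nCk+nC[k+1]≡[n+1]C[k+1] n k))))) ⟩
        fromℕ (n C k ℕ.+ n C suc k) * dfall a lam (n ∸ k) * dfall b lam (suc k)
          ≈⟨ *-congʳ (*-congʳ (fromℕ-+ (n C k) (n C suc k))) ⟩
        (fromℕ (n C k) + fromℕ (n C suc k)) * dfall a lam (n ∸ k) * dfall b lam (suc k)
          ≈⟨ solve 4 (λ c c′ A B → (c :+ c′) :* A :* B := c :* A :* B :+ c′ :* A :* B)
                     refl _ _ _ _ ⟩
        raise-b k + raise-a (suc k) ∎

  whitneySummand : (M r lam : Carrier) (S : ℕ → ℕ → Carrier) (n j k l : ℕ) → Carrier
  whitneySummand M r lam S n j k l =
    fromℕ (n C k) * fromℕ (k C l) * dfall (r - 1#) lam (n ∸ k)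
      * dfall 1# lam (k ∸ l) * pow M (l ∸ j) * S l j

  whitneyCoefficient : (M r lam : Carrier) (S : ℕ → ℕ → Carrier) → ℕ → ℕ → Carrier
  whitneyCoefficient M r lam S n j =
    sumFromTo j n (λ k → sumFromTo j k (whitneySummand M r lam S n j k))

  whitneyCoefficient-vanish : ∀ M r lam S {n j} → n ℕ.< j →
                              whitneyCoefficient M r lam S n j ≈ 0#
  whitneyCoefficient-vanish M r lam S {n} {j} n<j =
    sumFromTo-empty n<j (λ k → sumFromTo j k (whitneySummand M r lam S n j k))

  dfall-affine-expansion :
    ∀ {M μ lam} → μ * M ≈ lam → ∀ r (S : ℕ → ℕ → Carrier) →
    (∀ l x → dfall x μ l ≈ sumFromTo 0 l (λ j → S l j * fall x j)) →
    ∀ n x → dfall (M * x + r) lam n ≈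
            sumFromTo 0 n (λ j → whitneyCoefficient M r lam S n j * pow M j * fall x j)
  dfall-affine-expansion {M} {μ} {lam} μM≈lam r S stirling n x = begin
    dfall (M * x + r) lam n
      ≈⟨ dfall-congˡ lam n shift ⟩
    dfall ((r - 1#) + (1# + M * x)) lam n
      ≈⟨ dfall-+ (r - 1#) (1# + M * x) lam n ⟩
    sumFromTo 0 n (λ k → outer k * dfall (1# + M * x) lam k)
      ≈⟨ sumBelow-cong (suc n) (λ k _ → expand-outer k) ⟩
    sumFromTo 0 n (λ k → sumFromTo 0 k (λ l → sumFromTo 0 l (term k l)))
      ≈⟨ sumBelow-cong (suc n) (λ k _ → sumFromTo-triangle k (term k)) ⟩
    sumFromTo 0 n (λ k → sumFromTo 0 k (λ j → sumFromTo j k (λ l → term k l j)))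
      ≈⟨ sumFromTo-triangle n (λ k j → sumFromTo j k (λ l → term k l j)) ⟩
    sumFromTo 0 n (λ j → sumFromTo j n (λ k → sumFromTo j k (λ l → term k l j)))
      ≈⟨ sumBelow-cong (suc n) (λ j _ → collect j) ⟩
    sumFromTo 0 n (λ j → whitneyCoefficient M r lam S n j * pow M j * fall x j) ∎
    where
    outer : ℕ → Carrier
    outer k = fromℕ (n C k) * dfall (r - 1#) lam (n ∸ k)
    inner : ℕ → ℕ → Carrier
    inner k l = fromℕ (k C l) * dfall 1# lam (k ∸ l)
    summand : ℕ → ℕ → ℕ → Carrier
    summand = whitneySummand M r lam S n
    term : ℕ → ℕ → ℕ → Carrier
    term k l j = fromℕ (n C k) * fromℕ (k C l) * dfall (r - 1#) lam (n ∸ k)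
                   * dfall 1# lam (k ∸ l) * pow M l * S l j * fall x j

    shift : M * x + r ≈ (r - 1#) + (1# + M * x)
    shift = sym (begin
      (r - 1#) + (1# + M * x)
        ≈⟨ solve 4 (λ r m 1′ y → (r :+ m) :+ (1′ :+ y) := r :+ ((m :+ 1′) :+ y)) refl _ _ _ _ ⟩
      r + ((- 1# + 1#) + M * x)
        ≈⟨ +-congˡ (trans (+-congʳ (-‿inverseˡ 1#)) (+-identityˡ _)) ⟩
      r + M * x
        ≈⟨ +-comm r _ ⟩
      M * x + r ∎)

    expand-inner : ∀ k l → outer k * (inner k l * dfall (M * x) lam l) ≈
                           sumFromTo 0 l (term k l)
    expand-inner k l = begin
      outer k * (inner k l * dfall (M * x) lam l)
        ≈⟨ *-congˡ (*-congˡ (trans (dfall-scale μM≈lam x l) (*-congˡ (stirling l x)))) ⟩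
      outer k * (inner k l * (pow M l * sumFromTo 0 l (λ j → S l j * fall x j)))
        ≈⟨ solve 4 (λ o i p s → o :* (i :* (p :* s)) := o :* i :* p :* s) refl _ _ _ _ ⟩
      outer k * inner k l * pow M l * sumFromTo 0 l (λ j → S l j * fall x j)
        ≈⟨ *-distribˡ-sumFromTo 0 l _ _ ⟩
      sumFromTo 0 l (λ j → outer k * inner k l * pow M l * (S l j * fall x j))
        ≈⟨ sumBelow-cong (suc l) (λ j _ → solve 7 (λ c A c′ B p s f →
             c :* A :* (c′ :* B) :* p :* (s :* f) := c :* c′ :* A :* B :* p :* s :* f)
             refl _ _ _ _ _ _ _) ⟩
      sumFromTo 0 l (term k l) ∎

    expand-outer : ∀ k → outer k * dfall (1# + M * x) lam k ≈
                         sumFromTo 0 k (λ l → sumFromTo 0 l (term k l))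
    expand-outer k = begin
      outer k * dfall (1# + M * x) lam k
        ≈⟨ *-congˡ (dfall-+ 1# (M * x) lam k) ⟩
      outer k * sumFromTo 0 k (λ l → inner k l * dfall (M * x) lam l)
        ≈⟨ *-distribˡ-sumFromTo 0 k _ _ ⟩
      sumFromTo 0 k (λ l → outer k * (inner k l * dfall (M * x) lam l))
        ≈⟨ sumBelow-cong (suc k) (λ l _ → expand-inner k l) ⟩
      sumFromTo 0 k (λ l → sumFromTo 0 l (term k l)) ∎

    term-split : ∀ {k l j} → j ℕ.≤ l →
                 term k l j ≈ summand j k l * (pow M j * fall x j)
    term-split {k} {l} {j} j≤l = begin
      term k l j
        ≈⟨ *-congʳ (*-congʳ (*-congˡ
             (trans (reflexive (≡.cong (pow M) (≡.sym (ℕ.m∸n+n≡m j≤l)))) (pow-+ M (l ∸ j) j)))) ⟩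
      _ * (pow M (l ∸ j) * pow M j) * S l j * fall x j
        ≈⟨ solve 5 (λ q p p′ s f → q :* (p :* p′) :* s :* f := q :* p :* s :* (p′ :* f))
                   refl _ _ _ _ _ ⟩
      summand j k l * (pow M j * fall x j) ∎

    collect : ∀ j → sumFromTo j n (λ k → sumFromTo j k (λ l → term k l j))
                    ≈ whitneyCoefficient M r lam S n j * pow M j * fall x j
    collect j = begin
      sumFromTo j n (λ k → sumFromTo j k (λ l → term k l j))
        ≈⟨ sumFromTo-cong j n (λ k _ →
             trans (sumFromTo-cong j k (λ l → term-split {k}))
                   (sym (*-distribʳ-sumFromTo j k _ (summand j k)))) ⟩
      sumFromTo j n (λ k → sumFromTo j k (summand j k) * (pow M j * fall x j))
        ≈⟨ sym (*-distribʳ-sumFromTo j n _ (λ k → sumFromTo j k (summand j k))) ⟩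
      whitneyCoefficient M r lam S n j * (pow M j * fall x j)
        ≈⟨ sym (*-assoc _ _ _) ⟩
      whitneyCoefficient M r lam S n j * pow M j * fall x j ∎

module FallingFactorialBasis {c ℓ : Level} (ℝ : RealNumbers c ℓ) where
  open RealNumbers ℝ
  open Ops commRing
  open FiniteSums commRing
  open DegenerateFactorials commRing
  open IsStrictTotalOrder <-isStrictTotalOrder using (irrefl; <-respˡ-≈; <-respʳ-≈)
    renaming (trans to <-trans)
  open import Algebra.Properties.AbelianGroup +-abelianGroup using (∙-cancelˡ)
  open import Relation.Binary.Reasoning.Setoid setoid

  0<x⇒0<1+x : ∀ {x} → 0# < x → 0# < (1# + x)
  0<x⇒0<1+x {x} 0<x =
    <-trans 0<1 (<-respʳ-≈ (+-comm x 1#) (<-respˡ-≈ (+-identityˡ 1#) (+-monoˡ-< 1# 0<x)))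

  fromℕ-pos : ∀ {n} → 0 ℕ.< n → 0# < fromℕ n
  fromℕ-pos {suc zero}    _ = <-respʳ-≈ (sym (+-identityʳ 1#)) 0<1
  fromℕ-pos {suc (suc n)} _ = 0<x⇒0<1+x (fromℕ-pos {suc n} ℕ.z<s)

  pow-pos : ∀ {y} → 0# < y → ∀ k → 0# < pow y k
  pow-pos 0<y zero    = 0<1
  pow-pos 0<y (suc k) = *-pos (pow-pos 0<y k) 0<y

  fall-fromℕ-pos : ∀ {i k} → k ℕ.≤ i → 0# < fall (fromℕ i) k
  fall-fromℕ-pos {i} {zero}  _     = 0<1
  fall-fromℕ-pos {i} {suc k} k<i = *-pos (fall-fromℕ-pos (ℕ.<⇒≤ k<i))
    (<-respʳ-≈ (sym last-factor) (fromℕ-pos (ℕ.m<n⇒0<n∸m k<i)))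
    where
    last-factor : fromℕ i - fromℕ k * 1# ≈ fromℕ (i ∸ k)
    last-factor = begin
      fromℕ i - fromℕ k * 1#
        ≈⟨ +-cong (fromℕ-m∸n+n (ℕ.<⇒≤ k<i)) (-‿cong (*-identityʳ _)) ⟩
      (fromℕ (i ∸ k) + fromℕ k) - fromℕ k
        ≈⟨ +-assoc _ _ _ ⟩
      fromℕ (i ∸ k) + (fromℕ k - fromℕ k)
        ≈⟨ +-congˡ (-‿inverseʳ _) ⟩
      fromℕ (i ∸ k) + 0#
        ≈⟨ +-identityʳ _ ⟩
      fromℕ (i ∸ k) ∎

  *-cancelʳ-pos : ∀ {x y d} → 0# < d → x * d ≈ y * d → x ≈ y
  *-cancelʳ-pos {x} {y} {d} 0<d xd≈yd with inverse d (λ d≈0 → irrefl (sym d≈0) 0<d)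
  ... | e , de≈1 = begin
    x           ≈⟨ sym (trans (*-congˡ de≈1) (*-identityʳ x)) ⟩
    x * (d * e) ≈⟨ sym (*-assoc x d e) ⟩
    x * d * e   ≈⟨ *-congʳ xd≈yd ⟩
    y * d * e   ≈⟨ *-assoc y d e ⟩
    y * (d * e) ≈⟨ trans (*-congˡ de≈1) (*-identityʳ y) ⟩
    y           ∎

  fall-coefficients-unique :
    ∀ n (a b : ℕ → Carrier) →
    (∀ x → sumFromTo 0 n (λ k → a k * fall x k) ≈ sumFromTo 0 n (λ k → b k * fall x k)) →
    ∀ k → k ℕ.≤ n → a k ≈ b k
  fall-coefficients-unique n a b same = <-rec (λ i → i ℕ.≤ n → a i ≈ b i) step
    where
    -- At x = i the terms with t > i vanish and those with t < i agree by induction.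
    step : ∀ i → (∀ {t} → t ℕ.< i → t ℕ.≤ n → a t ≈ b t) → i ℕ.≤ n → a i ≈ b i
    step i below i≤n = *-cancelʳ-pos (fall-fromℕ-pos {i} ℕ.≤-refl) (∙-cancelˡ _ _ _ (begin
        sumBelow i (λ t → b t * fall (fromℕ i) t) + a i * fall (fromℕ i) i
          ≈⟨ +-congʳ (sym (sumBelow-cong i (λ t t<i →
               *-congʳ (below t<i (ℕ.<⇒≤ (ℕ.<-≤-trans t<i i≤n)))))) ⟩
        sumBelow (suc i) (λ t → a t * fall (fromℕ i) t)
          ≈⟨ sym (truncate a) ⟩
        sumFromTo 0 n (λ t → a t * fall (fromℕ i) t)
          ≈⟨ same (fromℕ i) ⟩
        sumFromTo 0 n (λ t → b t * fall (fromℕ i) t)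
          ≈⟨ truncate b ⟩
        sumBelow i (λ t → b t * fall (fromℕ i) t) + b i * fall (fromℕ i) i ∎))
      where
      truncate : ∀ c → sumFromTo 0 n (λ t → c t * fall (fromℕ i) t) ≈
                       sumBelow (suc i) (λ t → c t * fall (fromℕ i) t)
      truncate c = sumBelow-vanishing-tail _ (ℕ.≤⇒≤′ (ℕ.s≤s i≤n))
        (λ t i<t → trans (*-congˡ (fall-fromℕ-vanish i<t)) (zeroʳ (c t)))

theorem7 : ∀ {c ℓ : Level} (ℝ : RealNumbers c ℓ) →
    let open RealNumbers ℝ in
    let open Ops commRing in
    (m : ℕ) → 0 Data.Nat.< m →
    (r : Carrier) → 0# ≤ r →
    (λ' : Carrier) → ¬ (λ' ≈ 0#) →
    (μ : Carrier) → μ * fromℕ m ≈ λ' →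
    (S : ℕ → ℕ → Carrier) → IsDegStirling2 μ S →
    (W : ℕ → ℕ → Carrier) → IsDegWhitney2 m r λ' W →
    (n j : ℕ) →
    W n j ≈ sumFromTo j n (λ k → sumFromTo j k (λ l →
              fromℕ (n C k) * fromℕ (k C l) * dfall (r - 1#) λ' (n ∸ k)
                * dfall 1# λ' (k ∸ l) * pow (fromℕ m) (l ∸ j) * S l j))
theorem7 ℝ m 0<m r _ λ' _ μ μm≈λ' S (stirling , _) W (whitney , W-vanish) n j =
  [ within-degree , beyond-degree ]′ (ℕ.≤-<-connex j n)
  where
  open RealNumbers ℝ
  open Ops commRing
  open DegenerateFactorials commRing
  open FallingFactorialBasis ℝ

  within-degree : j ℕ.≤ n → W n j ≈ whitneyCoefficient (fromℕ m) r λ' S n j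
  within-degree j≤n = *-cancelʳ-pos (pow-pos (fromℕ-pos 0<m) j)
    (fall-coefficients-unique n _ _
      (λ x → trans (sym (whitney n x)) (dfall-affine-expansion μm≈λ' r S stirling n x)) j j≤n)

  beyond-degree : n ℕ.< j → W n j ≈ whitneyCoefficient (fromℕ m) r λ' S n j
  beyond-degree n<j =
    trans (W-vanish n j n<j) (sym (whitneyCoefficient-vanish (fromℕ m) r λ' S n<j))
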